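{- Let $G$ be a connected graph and let $e=vw\in E(G)$ be an edge that is not a bridge of $G$. Then $$\chi_d^t(G)-1\leq \chi_d^t(G-e)\leq \chi_d^t(G)+2.$$
   Context: All graphs are simple and finite. For a graph $H$ with no isolated vertex, a total dominator coloring (TD-coloring) of $H$ is a proper vertex coloring of $H$ in which every vertex is adjacent to every vertex of some color class (a class other than its own). The total dominator chromatic number $\chi_d^t(H)$ is the minimum number of colors in a TD-coloring of $H$. $G-e$ denotes the graph obtained from $G$ by deleting the edge $e$ (keeping all vertices). Implicitly, every graph whose $\chi_d^t$ appears has no isolated vertex. -}

module Defs where

open import Data.Nat using (ℕ; _≤_; _+_)
open import Data.Fin using (Fin)
open import Data.Product using (Σ; ∃; _×_; _,_; proj₁; proj₂)
open import Data.Sum using (_⊎_; inj₁; inj₂)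
open import Relation.Nullary using (¬_)
open import Relation.Binary.PropositionalEquality using (_≡_; _≢_)
open import Data.Empty using (⊥)

record Graph (n : ℕ) : Set₁ where
  field
    Adj   : Fin n → Fin n → Set
    sym   : ∀ {x y} → Adj x y → Adj y x
    irrefl : ∀ {x} → ¬ Adj x x
open Graph public

SamePair : ∀ {n} → Fin n → Fin n → Fin n → Fin n → Set
SamePair x y v w = (x ≡ v × y ≡ w) ⊎ (x ≡ w × y ≡ v)

private
  samePair-swap : ∀ {n} {x y v w : Fin n} → SamePair x y v w → SamePair y x v w
  samePair-swap (inj₁ (a , b)) = inj₂ (b , a)
  samePair-swap (inj₂ (a , b)) = inj₁ (b , a)

deleteEdge : ∀ {n} → Graph n → Fin n → Fin n → Graph n
deleteEdge G v w = record
  { Adj = λ x y → Adj G x y × ¬ SamePair x y v w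
  ; sym = λ { (a , ns) → sym G a , λ p → ns (samePair-swap p) }
  ; irrefl = λ { (a , _) → irrefl G a }
  }

data Reach {n} (G : Graph n) : Fin n → Fin n → Set where
  here : ∀ {x} → Reach G x x
  step : ∀ {x y z} → Adj G x y → Reach G y z → Reach G x z

Connected : ∀ {n} → Graph n → Set
Connected G = ∀ x y → Reach G x y

-- an edge vw is a bridge if deleting it disconnects its endpoints
-- (equivalently, its deletion increases the number of components)
IsBridge : ∀ {n} → Graph n → Fin n → Fin n → Set
IsBridge G v w = Adj G v w × ¬ Reach (deleteEdge G v w) v w

NoIsolated : ∀ {n} → Graph n → Set
NoIsolated G = ∀ x → ∃ λ y → Adj G x y

Proper : ∀ {n k} → Graph n → (Fin n → Fin k) → Set
Proper G c = ∀ {x y} → Adj G x y → c x ≢ c y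

DominatesClass : ∀ {n k} → Graph n → (Fin n → Fin k) → Fin n → Fin k → Set
DominatesClass G c x i =
  i ≢ c x × (∃ λ u → c u ≡ i) × (∀ u → c u ≡ i → Adj G x u)

IsTDColoring : ∀ {n k} → Graph n → (Fin n → Fin k) → Set
IsTDColoring G c = Proper G c × (∀ x → ∃ λ i → DominatesClass G c x i)

HasTDColoring : ∀ {n} → Graph n → ℕ → Set
HasTDColoring {n} G k = ∃ λ (c : Fin n → Fin k) → IsTDColoring G c

IsTDChromatic : ∀ {n} → Graph n → ℕ → Set
IsTDChromatic G k = HasTDColoring G k × (∀ m → HasTDColoring G m → k ≤ m)

-- Adding the edge vw to G − vw: give v a fresh colour. Each class of the new colouring lies
-- inside an old class, so domination survives, and vw now joins different colours.
-- Deleting a non-bridge edge vw from G: v has a neighbour u ≠ w and w a neighbour u′ ≠ v in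
-- G − vw; give u and u′ fresh colours. A vertex that dominated a class in G still dominates (a
-- part of) that class in G − vw unless it is v (resp. w) and the class contains w (resp. v); then
-- it dominates the singleton class {u} (resp. {u′}) instead.
module Submission where

open import Defs
open import Data.Nat using (ℕ; suc; _≤_; _+_; _≤?_)
open import Data.Nat.Properties using (+-comm)
open import Data.Fin using (Fin; fromℕ; inject₁)
open import Data.Fin.Properties using (_≟_; fromℕ≢inject₁; inject₁-injective)
open import Data.Product using (_×_; _,_; ∃; proj₁; proj₂)
open import Data.Sum using (_⊎_; inj₁; inj₂)
open import Data.Empty using (⊥-elim)
open import Function using (_∘_)
open import Relation.Nullary using (¬_; yes; no)
open import Relation.Nullary.Decidable using (decidable-stable; _×-dec_)
open import Relation.Binary.PropositionalEquality
  using (_≡_; _≢_; refl; cong; subst; trans) renaming (sym to ≡-sym)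

private
  variable
    n k m m′ : ℕ

Refines : (Fin n → Fin m) → (Fin n → Fin k) → Set
Refines d c = ∀ x y → d x ≡ d y → c x ≡ c y

IsolatedIn : (Fin n → Fin k) → Fin n → Set
IsolatedIn c a = ∀ x → c x ≡ c a → x ≡ a

isolated-refines : {d : Fin n → Fin m} {c : Fin n → Fin k} {a : Fin n} →
                   Refines d c → IsolatedIn c a → IsolatedIn d a
isolated-refines d⊑c a-iso x eq = a-iso x (d⊑c x _ eq)

refines-trans : {e : Fin n → Fin m} {d : Fin n → Fin k} {c : Fin n → Fin m′} →
                Refines e d → Refines d c → Refines e c
refines-trans e⊑d d⊑c x y eq = d⊑c x y (e⊑d x y eq)

isolate : (Fin n → Fin k) → Fin n → Fin n → Fin (suc k)
isolate {k = k} c a x with x ≟ a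
... | yes _ = fromℕ k
... | no _  = inject₁ (c x)

module _ (c : Fin n → Fin k) (a : Fin n) where

  isolate-cases : ∀ x → (x ≡ a × isolate c a x ≡ fromℕ k)
                      ⊎ (x ≢ a × isolate c a x ≡ inject₁ (c x))
  isolate-cases x with x ≟ a
  ... | yes x≡a = inj₁ (x≡a , refl)
  ... | no x≢a  = inj₂ (x≢a , refl)

  isolate-refines : Refines (isolate c a) c
  isolate-refines x y eq with isolate-cases x | isolate-cases y
  ... | inj₁ (x≡a , _)  | inj₁ (y≡a , _)  = cong c (trans x≡a (≡-sym y≡a))
  ... | inj₁ (_ , dx)   | inj₂ (_ , dy)   =
    ⊥-elim (fromℕ≢inject₁ (trans (≡-sym dx) (trans eq dy)))
  ... | inj₂ (_ , dx)   | inj₁ (_ , dy)   =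
    ⊥-elim (fromℕ≢inject₁ (trans (≡-sym dy) (trans (≡-sym eq) dx)))
  ... | inj₂ (_ , dx)   | inj₂ (_ , dy)   = inject₁-injective (trans (≡-sym dx) (trans eq dy))

  isolate-isolated : IsolatedIn (isolate c a) a
  isolate-isolated x eq with isolate-cases x | isolate-cases a
  ... | inj₁ (x≡a , _) | _              = x≡a
  ... | inj₂ _         | inj₂ (a≢a , _) = ⊥-elim (a≢a refl)
  ... | inj₂ (_ , dx)  | inj₁ (_ , da)  =
    ⊥-elim (fromℕ≢inject₁ (trans (≡-sym da) (trans (≡-sym eq) dx)))

  proper-isolate : (H H′ : Graph n) → Proper H c →
                   (∀ {x y} → Adj H′ x y → x ≢ a → y ≢ a → Adj H x y) →
                   Proper H′ (isolate c a)
  proper-isolate H H′ proper carry {x} {y} xy eq with isolate-cases x | isolate-cases y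
  ... | inj₁ (refl , _) | _               =
    irrefl H′ (subst (Adj H′ a) (isolate-isolated y (≡-sym eq)) xy)
  ... | inj₂ _          | inj₁ (refl , _) =
    irrefl H′ (subst (λ t → Adj H′ t a) (isolate-isolated x eq) xy)
  ... | inj₂ (x≢a , _)  | inj₂ (y≢a , _)  = proper (carry xy x≢a y≢a) (isolate-refines x y eq)

dominates-refines : (H H′ : Graph n) {d : Fin n → Fin m} {c : Fin n → Fin k}
                    {x : Fin n} {i : Fin k} →
                    Refines d c → DominatesClass H c x i →
                    (∀ z → c z ≡ i → Adj H x z → Adj H′ x z) →
                    ∃ λ j → DominatesClass H′ d x j
dominates-refines H H′ {d = d} d⊑c (i≢cx , (u , cu≡i) , adjacent) carry =
  d u , (λ du≡dx → i≢cx (trans (≡-sym cu≡i) (d⊑c u _ du≡dx))) , (u , refl) ,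
  λ z dz≡du → let cz≡i = trans (d⊑c z u dz≡du) cu≡i in carry z cz≡i (adjacent z cz≡i)

dominates-isolated : (H : Graph n) {d : Fin n → Fin k} {x a : Fin n} →
                     IsolatedIn d a → Adj H x a → ∃ λ j → DominatesClass H d x j
dominates-isolated H {d = d} {x} {a} a-iso xa =
  d a , (λ da≡dx → irrefl H (subst (Adj H x) (≡-sym (a-iso x (≡-sym da≡dx))) xa)) ,
  (a , refl) ,
  λ z dz≡da → subst (Adj H x) (≡-sym (a-iso z dz≡da)) xa

module _ (G : Graph n) (v w : Fin n) where

  private
    G′ : Graph n
    G′ = deleteEdge G v w

  deleteEdge-keeps : ∀ {x z} → Adj G x z → ¬ (x ≡ v × z ≡ w) → ¬ (x ≡ w × z ≡ v) → Adj G′ x z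
  deleteEdge-keeps xz ¬vw ¬wv = xz , λ { (inj₁ p) → ¬vw p ; (inj₂ p) → ¬wv p }

  hasTDColoring-addEdge : HasTDColoring G′ k → HasTDColoring G (suc k)
  hasTDColoring-addEdge (c , proper , dominates) =
    isolate c v ,
    proper-isolate c v G′ G proper
      (λ xy x≢v y≢v → deleteEdge-keeps xy (x≢v ∘ proj₁) (y≢v ∘ proj₂)) ,
    λ x → let (i , D) = dominates x in
          dominates-refines G′ G (isolate-refines c v) D (λ _ _ → proj₁)

  hasTDColoring-deleteEdge : ∀ {u u′} → Adj G′ v u → Adj G′ w u′ →
                             HasTDColoring G k → HasTDColoring G′ (suc (suc k))
  hasTDColoring-deleteEdge {k = k} {u = u} {u′} vu wu′ (c , proper , dominates) =
    d ,
    proper-isolate (isolate c u) u′ G G′ (proper-isolate c u G G proper λ xy _ _ → xy)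
      (λ xy _ _ → proj₁ xy) ,
    dominated
    where
    d : Fin n → Fin (suc (suc k))
    d = isolate (isolate c u) u′

    d⊑c : Refines d c
    d⊑c = refines-trans (isolate-refines (isolate c u) u′) (isolate-refines c u)

    u-isolated : IsolatedIn d u
    u-isolated = isolated-refines (isolate-refines (isolate c u) u′) (isolate-isolated c u)

    u′-isolated : IsolatedIn d u′
    u′-isolated = isolate-isolated (isolate c u) u′

    dominated : ∀ x → ∃ λ j → DominatesClass G′ d x j
    dominated x with dominates x
    ... | i , D with (x ≟ v) ×-dec (c w ≟ i) | (x ≟ w) ×-dec (c v ≟ i)
    ... | yes (refl , _) | _              = dominates-isolated G′ u-isolated vu
    ... | no _           | yes (refl , _) = dominates-isolated G′ u′-isolated wu′
    ... | no ¬vw         | no ¬wv         = dominates-refines G G′ d⊑c D λ z cz≡i xz →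
      deleteEdge-keeps xz (λ { (x≡v , refl) → ¬vw (x≡v , cz≡i) })
                          (λ { (x≡w , refl) → ¬wv (x≡w , cz≡i) })

module _ {H : Graph n} where

  reach-first-edge : ∀ {x y} → x ≢ y → Reach H x y → ∃ λ t → Adj H x t
  reach-first-edge x≢x here         = ⊥-elim (x≢x refl)
  reach-first-edge _   (step xt _) = _ , xt

  reach-last-edge : ∀ {x y} → x ≢ y → Reach H x y → ∃ λ t → Adj H t y
  reach-last-edge x≢x here         = ⊥-elim (x≢x refl)
  reach-last-edge _   (step xt ty) = last-edge xt ty
    where
    last-edge : ∀ {x t y} → Adj H x t → Reach H t y → ∃ λ s → Adj H s y
    last-edge {x} xt here         = x , xt
    last-edge     _  (step tt′ r) = last-edge tt′ r

theorem2p2 : ∀ {n} (G : Graph n) (v w : Fin n) →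
    Connected G → NoIsolated G → Adj G v w → ¬ IsBridge G v w →
    ∀ (k k′ : ℕ) → IsTDChromatic G k → IsTDChromatic (deleteEdge G v w) k′ →
    k ≤ k′ + 1 × k′ ≤ k + 2
theorem2p2 G v w _ _ vw ¬bridge k k′ (colG , minG) (colG′ , minG′) = lower , upper
  where
  v≢w : v ≢ w
  v≢w v≡w = irrefl G (subst (Adj G v) (≡-sym v≡w) vw)

  lower : k ≤ k′ + 1
  lower = subst (k ≤_) (+-comm 1 k′) (minG (suc k′) (hasTDColoring-addEdge G v w colG′))

  upper-from-walk : Reach (deleteEdge G v w) v w → k′ ≤ k + 2
  upper-from-walk walk with reach-first-edge v≢w walk | reach-last-edge v≢w walk
  ... | u , vu | u′ , u′w = subst (k′ ≤_) (+-comm 2 k)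
    (minG′ (suc (suc k)) (hasTDColoring-deleteEdge G v w vu (sym (deleteEdge G v w) u′w) colG))

  -- The upper bound is decidable, so it may be proved from ¬ ¬ (v and w joined in G − vw).
  upper : k′ ≤ k + 2
  upper = decidable-stable (k′ ≤? k + 2) λ k′≰k+2 →
    ¬bridge (vw , λ walk → k′≰k+2 (upper-from-walk walk))
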